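{- The system $\mathsf{DG}+\mathsf{ACA}_0^{\mathrm{st}}$ is inconsistent, where $\mathsf{ACA}_0$ is the statement $(\forall f\le_1 1)(\exists g\le_1 1)(\forall n^{0})\big[(\exists m^0)(f(n,m)=0)\leftrightarrow g(n)=0\big]$ (with $f(n,m)$ denoting $f$ applied to a code of the pair $(n,m)$), and $\mathsf{ACA}_0^{\mathrm{st}}$ is this statement with all quantifiers relativised to $\mathrm{st}$: $(\forall^{\mathrm{st}} f\le_1 1)(\exists^{\mathrm{st}} g\le_1 1)(\forall^{\mathrm{st}} n^{0})\big[(\exists^{\mathrm{st}} m^0)(f(n,m)=0)\leftrightarrow g(n)=0\big]$.
   Context: Finite types: $0$ is a type and if $\rho,\sigma$ are types so is $\rho\to\sigma$; type $1=0\to0$, $2=1\to0$. $\mathsf{E\text{ - }HA}^{\omega}$ is Heyting arithmetic in all finite types (intuitionistic logic, Gödel's $T$ constants) with extensionality. Equality $=_0$ is primitive; for $\tau=\tau_1\to\dots\to\tau_k\to0$, $x=_\tau y$ abbreviates $(\forall z_1\dots z_k)(xz_1\dots z_k=_0yz_1\dots z_k)$, and $\le_\tau$ likewise. Extensionality $(\mathsf E_{\rho\to\tau})$: $(\forall\varphi)(\forall x,y)(x=_\rho y\to\varphi(x)=_\tau\varphi(y))$, for all types. Binary sequences: $f\le_1 1$. Strong majorizability (Howard–Bezem): $x\le^*_0 y$ iff $x\le_0 y$; $x\le^*_{\rho\to\sigma}y$ iff for all $u,v$ with $u\le^*_\rho v$: $xu\le^*_\sigma yv$ and $yu\le^*_\sigma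 yv$. Monotone: $x\le^*x$; $\tilde\forall,\tilde\exists$ range over monotone objects. The language of $\mathsf{DG}$ adds predicates $\mathrm{st}^\sigma$ ("is standard"); $\forall^{\mathrm{st}},\exists^{\mathrm{st}}$ are the relativised quantifiers, $\tilde\forall^{\mathrm{st}},\tilde\exists^{\mathrm{st}}$ combine both restrictions. Internal = not containing $\mathrm{st}$. $\mathsf{DG}$ is $\mathsf{E\text{ - }HA}^\omega$ in the extended language plus: (a) $x=_\sigma y\to(\mathrm{st}(x)\to\mathrm{st}(y))$; (b) $\mathrm{st}(y)\to(x\le^*_\sigma y\to\mathrm{st}(x))$; (c) $\mathrm{st}(t)$ for closed terms $t$; (d) $\mathrm{st}(z)\to(\mathrm{st}(x)\to\mathrm{st}(zx))$; external induction $\Phi(0)\wedge(\forall^{\mathrm{st}}n)(\Phi(n)\to\Phi(n+1))\to(\forall^{\mathrm{st}}n)\Phi(n)$ for any $\Phi$; and for arbitrary $\Phi,\Psi$ and internal $\phi,\psi$: $\mathsf{mAC}^\omega$: $(\tilde\forall^{\mathrm{st}}x)(\tilde\exists^{\mathrm{st}}y)\Phi(x,y)\to(\tilde\exists^{\mathrm{st}}f)(\tilde\forall^{\mathrm{st}}x)(\exists y\le^*f(x))\Phi(x,y)$; $\mathsf R^\omega$: $(\forall x)(\exists^{\mathrm{st}}y)\Phi(x,y)\to(\tilde\exists^{\mathrm{st}}z)(\forall x)(\exists y\le^*z)\Phi(x,y)$; $\mathsf I^\omega$: $(\tilde\forall^{\mathrm{st}}z)(\exists x)(\forall y\le^*z)\phi(x,y)\to(\exists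 x)(\forall^{\mathrm{st}}y)\phi(x,y)$; $\mathsf{IP}^\omega_{\tilde\forall^{\mathrm{st}}}$: $[(\tilde\forall^{\mathrm{st}}x)\phi(x)\to(\tilde\exists^{\mathrm{st}}y)\Psi(y)]\to(\tilde\exists^{\mathrm{st}}z)[(\tilde\forall^{\mathrm{st}}x)\phi(x)\to(\tilde\exists y\le^*z)\Psi(y)]$; $\mathsf M^\omega$: $[(\tilde\forall^{\mathrm{st}}x)\phi(x)\to\psi]\to(\tilde\exists^{\mathrm{st}}y)[(\forall x\le^*y)\phi(x)\to\psi]$; $\mathsf{MAJ}^\omega$: $(\forall^{\mathrm{st}}x)(\exists^{\mathrm{st}}y)(x\le^*y)$. -}

module Defs where

-- Deep embedding of the system DG (van den Berg et al. style nonstandard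
-- Heyting arithmetic in all finite types) and the axiom ACA_0^st.

open import Data.List using (List; []; _∷_; map)
open import Data.List.Membership.Propositional using (_∈_)
open import Data.Sum using (_⊎_)

infixr 7 _⇒_
data Ty : Set where
  ι   : Ty                 -- the type 0
  _⇒_ : Ty → Ty → Ty

Ctx : Set
Ctx = List Ty

data _∋_ : Ctx → Ty → Set where
  here  : ∀ {Γ σ} → (σ ∷ Γ) ∋ σ
  there : ∀ {Γ σ τ} → Γ ∋ σ → (τ ∷ Γ) ∋ σ

-- Terms of Gödel's T (combinator version, Troelstra's Π, Σ, R)

infixl 9 _·_
data Tm (Γ : Ctx) : Ty → Set where
  var  : ∀ {σ} → Γ ∋ σ → Tm Γ σ
  zer  : Tm Γ ι
  suc' : Tm Γ (ι ⇒ ι)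
  Kc   : ∀ {ρ σ} → Tm Γ (ρ ⇒ σ ⇒ ρ)
  Sc   : ∀ {ρ σ τ} → Tm Γ ((ρ ⇒ σ ⇒ τ) ⇒ (ρ ⇒ σ) ⇒ ρ ⇒ τ)
  Rc   : ∀ {ρ} → Tm Γ (ρ ⇒ (ρ ⇒ ι ⇒ ρ) ⇒ ι ⇒ ρ)                      -- R x y 0 = x, R x y (S n) = y (R x y n) n
  _·_  : ∀ {σ τ} → Tm Γ (σ ⇒ τ) → Tm Γ σ → Tm Γ τ

Ren : Ctx → Ctx → Set
Ren Γ Δ = ∀ {σ} → Γ ∋ σ → Δ ∋ σ

liftR : ∀ {Γ Δ τ} → Ren Γ Δ → Ren (τ ∷ Γ) (τ ∷ Δ)
liftR r here      = here
liftR r (there x) = there (r x)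

renT : ∀ {Γ Δ σ} → Ren Γ Δ → Tm Γ σ → Tm Δ σ
renT r (var x) = var (r x)
renT r zer     = zer
renT r suc'    = suc'
renT r Kc      = Kc
renT r Sc      = Sc
renT r Rc      = Rc
renT r (t · u) = renT r t · renT r u

wkT : ∀ {Γ σ τ} → Tm Γ σ → Tm (τ ∷ Γ) σ
wkT = renT there

Sub : Ctx → Ctx → Set
Sub Γ Δ = ∀ {σ} → Γ ∋ σ → Tm Δ σ

liftS : ∀ {Γ Δ τ} → Sub Γ Δ → Sub (τ ∷ Γ) (τ ∷ Δ)
liftS s here      = var here
liftS s (there x) = wkT (s x)

subT : ∀ {Γ Δ σ} → Sub Γ Δ → Tm Γ σ → Tm Δ σ
subT s (var x) = s x
subT s zer     = zer
subT s suc'    = suc'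
subT s Kc      = Kc
subT s Sc      = Sc
subT s Rc      = Rc
subT s (t · u) = subT s t · subT s u

v0 : ∀ {Γ σ} → Tm (σ ∷ Γ) σ
v0 = var here

v1 : ∀ {Γ σ τ} → Tm (τ ∷ σ ∷ Γ) σ
v1 = var (there here)

v2 : ∀ {Γ σ τ ρ} → Tm (ρ ∷ τ ∷ σ ∷ Γ) σ
v2 = var (there (there here))

v3 : ∀ {Γ σ τ ρ μ} → Tm (μ ∷ ρ ∷ τ ∷ σ ∷ Γ) σ
v3 = var (there (there (there here)))

infixr 4 _⊃_
infixr 5 _∨'_
infixr 6 _∧'_
infix 7 _≐_
data Fm (Γ : Ctx) : Set where
  _≐_  : Tm Γ ι → Tm Γ ι → Fm Γ
  St   : ∀ {σ} → Tm Γ σ → Fm Γ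
  ⊥'   : Fm Γ
  _∧'_ : Fm Γ → Fm Γ → Fm Γ
  _∨'_ : Fm Γ → Fm Γ → Fm Γ
  _⊃_  : Fm Γ → Fm Γ → Fm Γ
  All  : (σ : Ty) → Fm (σ ∷ Γ) → Fm Γ
  Ex   : (σ : Ty) → Fm (σ ∷ Γ) → Fm Γ

renF : ∀ {Γ Δ} → Ren Γ Δ → Fm Γ → Fm Δ
renF r (s ≐ t)  = renT r s ≐ renT r t
renF r (St t)   = St (renT r t)
renF r ⊥'       = ⊥'
renF r (φ ∧' ψ) = renF r φ ∧' renF r ψ
renF r (φ ∨' ψ) = renF r φ ∨' renF r ψ
renF r (φ ⊃ ψ)  = renF r φ ⊃ renF r ψ
renF r (All σ φ) = All σ (renF (liftR r) φ)
renF r (Ex σ φ)  = Ex σ (renF (liftR r) φ)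

wkF : ∀ {Γ τ} → Fm Γ → Fm (τ ∷ Γ)
wkF = renF there

closedT : ∀ {Γ σ} → Tm [] σ → Tm Γ σ
closedT = renT (λ ())

closedF : ∀ {Γ} → Fm [] → Fm Γ
closedF = renF (λ ())

subF : ∀ {Γ Δ} → Sub Γ Δ → Fm Γ → Fm Δ
subF s (a ≐ b)  = subT s a ≐ subT s b
subF s (St t)   = St (subT s t)
subF s ⊥'       = ⊥'
subF s (φ ∧' ψ) = subF s φ ∧' subF s ψ
subF s (φ ∨' ψ) = subF s φ ∨' subF s ψ
subF s (φ ⊃ ψ)  = subF s φ ⊃ subF s ψ
subF s (All σ φ) = All σ (subF (liftS s) φ)
subF s (Ex σ φ)  = Ex σ (subF (liftS s) φ)

sub0 : ∀ {Γ σ} → Tm Γ σ → Sub (σ ∷ Γ) Γ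
sub0 t here      = t
sub0 t (there x) = var x

_[_] : ∀ {Γ σ} → Fm (σ ∷ Γ) → Tm Γ σ → Fm Γ
φ [ t ] = subF (sub0 t) φ

sucSub : ∀ {Γ} → Sub (ι ∷ Γ) (ι ∷ Γ)
sucSub here      = suc' · var here
sucSub (there x) = var (there x)

data Internal : ∀ {Γ} → Fm Γ → Set where
  i-eq  : ∀ {Γ} {s t : Tm Γ ι} → Internal (s ≐ t)
  i-bot : ∀ {Γ} → Internal {Γ} ⊥'
  i-and : ∀ {Γ} {φ ψ : Fm Γ} → Internal φ → Internal ψ → Internal (φ ∧' ψ)
  i-or  : ∀ {Γ} {φ ψ : Fm Γ} → Internal φ → Internal ψ → Internal (φ ∨' ψ)
  i-imp : ∀ {Γ} {φ ψ : Fm Γ} → Internal φ → Internal ψ → Internal (φ ⊃ ψ)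
  i-all : ∀ {Γ σ} {φ : Fm (σ ∷ Γ)} → Internal φ → Internal (All σ φ)
  i-ex  : ∀ {Γ σ} {φ : Fm (σ ∷ Γ)} → Internal φ → Internal (Ex σ φ)

¬' : ∀ {Γ} → Fm Γ → Fm Γ
¬' φ = φ ⊃ ⊥'

_⇔'_ : ∀ {Γ} → Fm Γ → Fm Γ → Fm Γ
φ ⇔' ψ = (φ ⊃ ψ) ∧' (ψ ⊃ φ)

Ic : ∀ {Γ σ} → Tm Γ (σ ⇒ σ)
Ic {σ = σ} = Sc {ρ = σ} {σ = σ ⇒ σ} {τ = σ} · Kc · Kc

lam : ∀ {Γ σ τ} → Tm (σ ∷ Γ) τ → Tm Γ (σ ⇒ τ)
lam (var here)      = Ic
lam (var (there x)) = Kc · var x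
lam zer             = Kc · zer
lam suc'            = Kc · suc'
lam Kc              = Kc · Kc
lam Sc              = Kc · Sc
lam Rc              = Kc · Rc
lam (t · u)         = Sc · lam t · lam u

plus : ∀ {Γ} → Tm Γ (ι ⇒ ι ⇒ ι)
plus = lam (lam (Rc · v1 · lam (lam (suc' · v1)) · v0))

tri : ∀ {Γ} → Tm Γ (ι ⇒ ι)
tri = lam (Rc · zer · lam (lam (plus · v1 · (suc' · v0))) · v0)

-- Cantor pairing: pair n m = tri (n + m) + m  (the code of (n, m))
pair : ∀ {Γ} → Tm Γ (ι ⇒ ι ⇒ ι)
pair = lam (lam (plus · (tri · (plus · v1 · v0)) · v0))

_≤₀_ : ∀ {Γ} → Tm Γ ι → Tm Γ ι → Fm Γ
s ≤₀ t = Ex ι (plus · wkT s · v0 ≐ wkT t)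

eqF : ∀ {Γ} (σ : Ty) → Tm Γ σ → Tm Γ σ → Fm Γ
eqF ι s t       = s ≐ t
eqF (ρ ⇒ τ) s t = All ρ (eqF τ (wkT s · v0) (wkT t · v0))

leF : ∀ {Γ} (σ : Ty) → Tm Γ σ → Tm Γ σ → Fm Γ
leF ι s t       = s ≤₀ t
leF (ρ ⇒ τ) s t = All ρ (leF τ (wkT s · v0) (wkT t · v0))

maj : ∀ {Γ} (σ : Ty) → Tm Γ σ → Tm Γ σ → Fm Γ
maj ι x y       = x ≤₀ y
maj (ρ ⇒ τ) x y =
  All ρ (All ρ (maj ρ v1 v0 ⊃
    (maj τ (wkT (wkT x) · v1) (wkT (wkT y) · v0) ∧'
     maj τ (wkT (wkT y) · v1) (wkT (wkT y) · v0))))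

-- Relativised / monotone quantifiers (bound variable = variable 0)

AllSt ExSt AllM ExM AllMSt ExMSt : ∀ {Γ} (σ : Ty) → Fm (σ ∷ Γ) → Fm Γ
AllSt σ φ  = All σ (St v0 ⊃ φ)
ExSt σ φ   = Ex σ (St v0 ∧' φ)
AllM σ φ   = All σ (maj σ v0 v0 ⊃ φ)
ExM σ φ    = Ex σ (maj σ v0 v0 ∧' φ)
AllMSt σ φ = AllM σ (St v0 ⊃ φ)
ExMSt σ φ  = ExM σ (St v0 ∧' φ)

AllLe ExLe ExMLe : ∀ {Γ} (σ : Ty) → Tm Γ σ → Fm (σ ∷ Γ) → Fm Γ
AllLe σ z φ = All σ (maj σ v0 (wkT z) ⊃ φ)
ExLe σ z φ  = Ex σ (maj σ v0 (wkT z) ∧' φ)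
ExMLe σ z φ = ExM σ (maj σ v0 (wkT z) ∧' φ)

skip2 : ∀ {Γ σ τ ρ} → Ren (τ ∷ σ ∷ Γ) (τ ∷ σ ∷ ρ ∷ Γ)
skip2 = liftR (liftR there)

skip1 : ∀ {Γ σ ρ} → Ren (σ ∷ Γ) (σ ∷ ρ ∷ Γ)
skip1 = liftR there

-- Axioms of DG (schemes; free variables of a scheme instance are
-- parameters, the instance is available in every context)

data DG : ∀ {Γ} → Fm Γ → Set where
  eq-refl  : ∀ {Γ} (t : Tm Γ ι) → DG (t ≐ t)
  eq-repl  : ∀ {Γ} (s t : Tm Γ ι) (φ : Fm (ι ∷ Γ)) → DG (s ≐ t ⊃ φ [ s ] ⊃ φ [ t ])
  suc-ne0  : ∀ {Γ} (t : Tm Γ ι) → DG (¬' (suc' · t ≐ zer))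
  suc-inj  : ∀ {Γ} (s t : Tm Γ ι) → DG (suc' · s ≐ suc' · t ⊃ s ≐ t)
  ax-K     : ∀ {Γ ρ σ} (x : Tm Γ ρ) (y : Tm Γ σ) → DG (eqF ρ (Kc · x · y) x)
  ax-S     : ∀ {Γ ρ σ τ} (x : Tm Γ (ρ ⇒ σ ⇒ τ)) (y : Tm Γ (ρ ⇒ σ)) (z : Tm Γ ρ) →
             DG (eqF τ (Sc · x · y · z) (x · z · (y · z)))
  ax-R0    : ∀ {Γ ρ} (x : Tm Γ ρ) (y : Tm Γ (ρ ⇒ ι ⇒ ρ)) → DG (eqF ρ (Rc · x · y · zer) x)
  ax-RS    : ∀ {Γ ρ} (x : Tm Γ ρ) (y : Tm Γ (ρ ⇒ ι ⇒ ρ)) (n : Tm Γ ι) →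
             DG (eqF ρ (Rc · x · y · (suc' · n)) (y · (Rc · x · y · n) · n))
  ext      : ∀ {Γ ρ τ} (f : Tm Γ (ρ ⇒ τ)) (x y : Tm Γ ρ) → DG (eqF ρ x y ⊃ eqF τ (f · x) (f · y))
  ind      : ∀ {Γ} (φ : Fm (ι ∷ Γ)) → Internal φ →
             DG ((φ [ zer ] ∧' All ι (φ ⊃ subF sucSub φ)) ⊃ All ι φ)
  st-eq    : ∀ {Γ σ} (x y : Tm Γ σ) → DG (eqF σ x y ⊃ (St x ⊃ St y))
  st-maj   : ∀ {Γ σ} (x y : Tm Γ σ) → DG (St y ⊃ (maj σ x y ⊃ St x))
  st-closed : ∀ {Γ σ} (t : Tm [] σ) → DG {Γ} (St (closedT t))
  st-app   : ∀ {Γ σ τ} (z : Tm Γ (σ ⇒ τ)) (x : Tm Γ σ) → DG (St z ⊃ (St x ⊃ St (z · x)))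
  ind-st   : ∀ {Γ} (Φ : Fm (ι ∷ Γ)) →
             DG ((Φ [ zer ] ∧' AllSt ι (Φ ⊃ subF sucSub Φ)) ⊃ AllSt ι Φ)
  -- mAC^ω  (Φ(x,y): x = variable 1 of type σ, y = variable 0 of type τ)
  mAC      : ∀ {Γ σ τ} (Φ : Fm (τ ∷ σ ∷ Γ)) →
             DG (AllMSt σ (ExMSt τ Φ) ⊃
                 ExMSt (σ ⇒ τ) (AllMSt σ (ExLe τ (v1 · v0) (renF skip2 Φ))))
  Rω       : ∀ {Γ σ τ} (Φ : Fm (τ ∷ σ ∷ Γ)) →
             DG (All σ (ExSt τ Φ) ⊃ ExMSt τ (All σ (ExLe τ v1 (renF skip2 Φ))))
  -- I^ω  (φ(x,y) internal: x = variable 1 of type σ, y = variable 0 of type τ)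
  Iω       : ∀ {Γ σ τ} (φ : Fm (τ ∷ σ ∷ Γ)) → Internal φ →
             DG (AllMSt τ (Ex σ (AllLe τ v1 (renF skip2 φ))) ⊃ Ex σ (AllSt τ φ))
  IP       : ∀ {Γ σ τ} (φ : Fm (σ ∷ Γ)) (Ψ : Fm (τ ∷ Γ)) → Internal φ →
             DG ((AllMSt σ φ ⊃ ExMSt τ Ψ) ⊃
                 ExMSt τ (wkF (AllMSt σ φ) ⊃ ExMLe τ v0 (renF skip1 Ψ)))
  Mω       : ∀ {Γ σ} (φ : Fm (σ ∷ Γ)) (ψ : Fm Γ) → Internal φ → Internal ψ →
             DG ((AllMSt σ φ ⊃ ψ) ⊃ ExMSt σ (AllLe σ v0 (renF skip1 φ) ⊃ wkF ψ))
  MAJ      : ∀ {Γ} (σ : Ty) → DG {Γ} (AllSt σ (ExSt σ (maj σ v1 v0)))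

Theory : Set₁
Theory = ∀ {Γ} → Fm Γ → Set

data Prf (T : Theory) : (Γ : Ctx) → List (Fm Γ) → Fm Γ → Set where
  ax   : ∀ {Γ Δ φ} → T φ → Prf T Γ Δ φ
  hyp  : ∀ {Γ Δ φ} → φ ∈ Δ → Prf T Γ Δ φ
  ⊥E   : ∀ {Γ Δ φ} → Prf T Γ Δ ⊥' → Prf T Γ Δ φ
  ∧I   : ∀ {Γ Δ φ ψ} → Prf T Γ Δ φ → Prf T Γ Δ ψ → Prf T Γ Δ (φ ∧' ψ)
  ∧E₁  : ∀ {Γ Δ φ ψ} → Prf T Γ Δ (φ ∧' ψ) → Prf T Γ Δ φ
  ∧E₂  : ∀ {Γ Δ φ ψ} → Prf T Γ Δ (φ ∧' ψ) → Prf T Γ Δ ψ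
  ∨I₁  : ∀ {Γ Δ φ ψ} → Prf T Γ Δ φ → Prf T Γ Δ (φ ∨' ψ)
  ∨I₂  : ∀ {Γ Δ φ ψ} → Prf T Γ Δ ψ → Prf T Γ Δ (φ ∨' ψ)
  ∨E   : ∀ {Γ Δ φ ψ χ} → Prf T Γ Δ (φ ∨' ψ) → Prf T Γ (φ ∷ Δ) χ → Prf T Γ (ψ ∷ Δ) χ →
         Prf T Γ Δ χ
  ⊃I   : ∀ {Γ Δ φ ψ} → Prf T Γ (φ ∷ Δ) ψ → Prf T Γ Δ (φ ⊃ ψ)
  ⊃E   : ∀ {Γ Δ φ ψ} → Prf T Γ Δ (φ ⊃ ψ) → Prf T Γ Δ φ → Prf T Γ Δ ψ
  ∀I   : ∀ {Γ Δ σ φ} → Prf T (σ ∷ Γ) (map wkF Δ) φ → Prf T Γ Δ (All σ φ)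
  ∀E   : ∀ {Γ Δ σ φ} → Prf T Γ Δ (All σ φ) → (t : Tm Γ σ) → Prf T Γ Δ (φ [ t ])
  ∃I   : ∀ {Γ Δ σ φ} (t : Tm Γ σ) → Prf T Γ Δ (φ [ t ]) → Prf T Γ Δ (Ex σ φ)
  ∃E   : ∀ {Γ Δ σ φ ψ} → Prf T Γ Δ (Ex σ φ) → Prf T (σ ∷ Γ) (φ ∷ map wkF Δ) (wkF ψ) →
         Prf T Γ Δ ψ

Inconsistent : Theory → Set
Inconsistent T = Prf T [] [] ⊥'

τ₁ : Ty
τ₁ = ι ⇒ ι

oneF : ∀ {Γ} → Tm Γ τ₁
oneF = Kc · (suc' · zer)

ACAst : Fm []
ACAst =
  AllSt τ₁ (leF τ₁ v0 oneF ⊃                                   -- f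
   ExSt τ₁ (leF τ₁ v0 oneF ∧'                                   -- g
    AllSt ι                                                     -- n
     (ExSt ι (v3 · (pair · v1 · v0) ≐ zer)                      -- m
       ⇔' (v1 · v0 ≐ zer))))

data ACAstAx : ∀ {Γ} → Fm Γ → Set where
  aca : ∀ {Γ} → ACAstAx {Γ} (closedF ACAst)

DG+ACAst : Theory
DG+ACAst φ = DG φ ⊎ ACAstAx φ

-- For every x the sequence χ≤ x, the characteristic function of [0, x], is
-- majorised by the closed term λk.1 and hence standard, so ACA₀^st decides
-- whether some standard m satisfies x < ⟨0, m⟩.  Consequently every x has a
-- standard m with x < ⟨0, m⟩ whenever such a standard m exists at all, and R^ω
-- bounds these witnesses by a single standard z.  For x := p 0 z, with p a
-- standard majorant of the pairing function, this fails: x + 1 is standard and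
-- x < ⟨0, x + 1⟩, yet every m ≤ z has ⟨0, m⟩ ≤ p 0 z = x.

module Submission where

open import Data.List using (List; []; _∷_)
open import Data.List.Relation.Unary.Any using (here; there)
open import Data.Maybe using (Maybe; just; nothing)
open import Data.Nat using (ℕ; zero; suc)
open import Data.Product using (Σ; _,_; proj₁; proj₂)
open import Data.Sum using (inj₁; inj₂)
open import Relation.Binary.Bundles using (Setoid)
open import Relation.Binary.PropositionalEquality using (_≡_; refl; sym; trans; cong; cong₂; subst)
import Relation.Binary.Reasoning.Setoid as SetoidReasoning

open import Defs

infix 2 _⊢_
_⊢_ : ∀ {Γ} → List (Fm Γ) → Fm Γ → Set
_⊢_ {Γ} = Prf DG+ACAst Γ

dg-axiom : ∀ {Γ} {Δ : List (Fm Γ)} {φ : Fm Γ} → DG φ → Δ ⊢ φ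
dg-axiom d = ax (inj₁ d)

aca-axiom : ∀ {Γ} {Δ : List (Fm Γ)} → Δ ⊢ closedF ACAst
aca-axiom = ax (inj₂ aca)

hyp₀ : ∀ {Γ} {φ : Fm Γ} {Δ} → φ ∷ Δ ⊢ φ
hyp₀ = hyp (here refl)

hyp₁ : ∀ {Γ} {φ ψ : Fm Γ} {Δ} → ψ ∷ φ ∷ Δ ⊢ φ
hyp₁ = hyp (there (here refl))

hyp₂ : ∀ {Γ} {φ ψ χ : Fm Γ} {Δ} → χ ∷ ψ ∷ φ ∷ Δ ⊢ φ
hyp₂ = hyp (there (there (here refl)))

hyp₃ : ∀ {Γ} {φ ψ χ ω : Fm Γ} {Δ} → ω ∷ χ ∷ ψ ∷ φ ∷ Δ ⊢ φ
hyp₃ = hyp (there (there (there (here refl))))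

subT-renT : ∀ {Γ Δ Θ σ} (s : Sub Δ Θ) (r : Ren Γ Δ) (t : Tm Γ σ) →
            subT s (renT r t) ≡ subT (λ x → s (r x)) t
subT-renT s r (var x) = refl
subT-renT s r zer     = refl
subT-renT s r suc'    = refl
subT-renT s r Kc      = refl
subT-renT s r Sc      = refl
subT-renT s r Rc      = refl
subT-renT s r (t · u) = cong₂ _·_ (subT-renT s r t) (subT-renT s r u)

renT-subT : ∀ {Γ Δ Θ σ} (r : Ren Δ Θ) (s : Sub Γ Δ) (t : Tm Γ σ) →
            renT r (subT s t) ≡ subT (λ x → renT r (s x)) t
renT-subT r s (var x) = refl
renT-subT r s zer     = refl
renT-subT r s suc'    = refl
renT-subT r s Kc      = refl
renT-subT r s Sc      = refl
renT-subT r s Rc      = refl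
renT-subT r s (t · u) = cong₂ _·_ (renT-subT r s t) (renT-subT r s u)

subT-var : ∀ {Γ σ} (t : Tm Γ σ) → subT var t ≡ t
subT-var (var x) = refl
subT-var zer     = refl
subT-var suc'    = refl
subT-var Kc      = refl
subT-var Sc      = refl
subT-var Rc      = refl
subT-var (t · u) = cong₂ _·_ (subT-var t) (subT-var u)

subT-sub0-wkT : ∀ {Γ σ τ} (a : Tm Γ τ) (t : Tm Γ σ) → subT (sub0 a) (wkT t) ≡ t
subT-sub0-wkT a t = trans (subT-renT (sub0 a) there t) (subT-var t)

subT-liftS-wkT : ∀ {Γ Δ σ τ} (s : Sub Γ Δ) (t : Tm Γ σ) →
                 subT (liftS {τ = τ} s) (wkT t) ≡ wkT (subT s t)
subT-liftS-wkT s t = trans (subT-renT (liftS s) there t) (sym (renT-subT there s t))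

subF-eqF : ∀ {Γ Δ} (s : Sub Γ Δ) (τ : Ty) (a b : Tm Γ τ) →
           subF s (eqF τ a b) ≡ eqF τ (subT s a) (subT s b)
subF-eqF s ι       a b = refl
subF-eqF s (ρ ⇒ τ) a b = cong (All ρ) (trans (subF-eqF (liftS s) τ (wkT a · v0) (wkT b · v0))
  (cong₂ (λ a′ b′ → eqF τ (a′ · v0) (b′ · v0)) (subT-liftS-wkT s a) (subT-liftS-wkT s b)))

renT-renT : ∀ {Γ Δ Θ σ} (r : Ren Δ Θ) (r′ : Ren Γ Δ) (t : Tm Γ σ) →
            renT r (renT r′ t) ≡ renT (λ x → r (r′ x)) t
renT-renT r r′ (var x) = refl
renT-renT r r′ zer     = refl
renT-renT r r′ suc'    = refl
renT-renT r r′ Kc      = refl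
renT-renT r r′ Sc      = refl
renT-renT r r′ Rc      = refl
renT-renT r r′ (t · u) = cong₂ _·_ (renT-renT r r′ t) (renT-renT r r′ u)

renT-liftR-wkT : ∀ {Γ Δ σ τ} (r : Ren Γ Δ) (t : Tm Γ σ) →
                 renT (liftR {τ = τ} r) (wkT t) ≡ wkT (renT r t)
renT-liftR-wkT r t = trans (renT-renT (liftR r) there t) (sym (renT-renT there r t))

renF-eqF : ∀ {Γ Δ} (r : Ren Γ Δ) (τ : Ty) (a b : Tm Γ τ) →
           renF r (eqF τ a b) ≡ eqF τ (renT r a) (renT r b)
renF-eqF r ι       a b = refl
renF-eqF r (ρ ⇒ τ) a b = cong (All ρ) (trans (renF-eqF (liftR r) τ (wkT a · v0) (wkT b · v0))
  (cong₂ (λ a′ b′ → eqF τ (a′ · v0) (b′ · v0)) (renT-liftR-wkT r a) (renT-liftR-wkT r b)))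

∀E-eqF : ∀ {Γ} {Δ : List (Fm Γ)} {ρ τ} {f g : Tm Γ (ρ ⇒ τ)} →
         Δ ⊢ eqF (ρ ⇒ τ) f g → (a : Tm Γ ρ) → Δ ⊢ eqF τ (f · a) (g · a)
∀E-eqF {τ = τ} {f} {g} f≐g a = subst (_ ⊢_)
  (trans (subF-eqF (sub0 a) τ (wkT f · v0) (wkT g · v0))
         (cong₂ (λ f′ g′ → eqF τ (f′ · a) (g′ · a)) (subT-sub0-wkT a f) (subT-sub0-wkT a g)))
  (∀E f≐g a)

≐-refl : ∀ {Γ} {Δ : List (Fm Γ)} (t : Tm Γ ι) → Δ ⊢ t ≐ t
≐-refl t = dg-axiom (eq-refl t)

≐-replace : ∀ {Γ} {Δ : List (Fm Γ)} {s t : Tm Γ ι} (C : Tm (ι ∷ Γ) ι) (u : Tm Γ ι) →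
            Δ ⊢ s ≐ t → Δ ⊢ subT (sub0 s) C ≐ u → Δ ⊢ subT (sub0 t) C ≐ u
≐-replace {Δ = Δ} {s} {t} C u s≐t Cs≐u =
  subst (λ w → Δ ⊢ subT (sub0 t) C ≐ w) (subT-sub0-wkT t u)
    (⊃E (⊃E (dg-axiom (eq-repl s t (C ≐ wkT u))) s≐t)
        (subst (λ w → Δ ⊢ subT (sub0 s) C ≐ w) (sym (subT-sub0-wkT s u)) Cs≐u))

≐-sym : ∀ {Γ} {Δ : List (Fm Γ)} {s t : Tm Γ ι} → Δ ⊢ s ≐ t → Δ ⊢ t ≐ s
≐-sym {s = s} s≐t = ≐-replace v0 s s≐t (≐-refl s)

≐-trans : ∀ {Γ} {Δ : List (Fm Γ)} {s t u : Tm Γ ι} → Δ ⊢ s ≐ t → Δ ⊢ t ≐ u → Δ ⊢ s ≐ u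
≐-trans {u = u} s≐t t≐u = ≐-replace v0 u (≐-sym s≐t) t≐u

≐-cong : ∀ {Γ} {Δ : List (Fm Γ)} {s t : Tm Γ ι} (C : Tm (ι ∷ Γ) ι) →
         Δ ⊢ s ≐ t → Δ ⊢ subT (sub0 s) C ≐ subT (sub0 t) C
≐-cong {s = s} C s≐t = ≐-sym (≐-replace C (subT (sub0 s) C) s≐t (≐-refl _))

≐-setoid : ∀ {Γ} → List (Fm Γ) → Setoid _ _
≐-setoid {Γ} Δ = record
  { Carrier       = Tm Γ ι
  ; _≈_           = λ s t → Δ ⊢ s ≐ t
  ; isEquivalence = record { refl = ≐-refl _ ; sym = ≐-sym ; trans = ≐-trans }
  }

module ≐-Reasoning {Γ} {Δ : List (Fm Γ)} = SetoidReasoning (≐-setoid Δ)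

-- Each contraction of a K, S or R redex is an instance of the corresponding
-- axiom, carried into the surrounding term by extensionality; hence
-- normalising a term also derives its equality with the normal form.
Reduct : ∀ {Γ σ} → Tm Γ σ → Set
Reduct {Γ} {σ} t = Maybe (Σ (Tm Γ σ) λ t′ → ∀ {Δ : List (Fm Γ)} → Δ ⊢ eqF σ t t′)

reduce : ∀ {Γ σ} (t : Tm Γ σ) → Reduct t
reduce-app : ∀ {Γ ρ σ} (f : Tm Γ (ρ ⇒ σ)) (a : Tm Γ ρ) → Reduct (f · a)
reduce-inside : ∀ {Γ ρ σ} (f : Tm Γ (ρ ⇒ σ)) (a : Tm Γ ρ) → Reduct f → Reduct a → Reduct (f · a)

reduce (f · a) = reduce-app f a
reduce _       = nothing

reduce-app (Kc · x) y               = just (x , dg-axiom (ax-K x y))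
reduce-app (Sc · x · y) z           = just (x · z · (y · z) , dg-axiom (ax-S x y z))
reduce-app (Rc · x · y) zer         = just (x , dg-axiom (ax-R0 x y))
reduce-app (Rc · x · y) (suc' · n)  = just (y · (Rc · x · y · n) · n , dg-axiom (ax-RS x y n))
reduce-app f a                      = reduce-inside f a (reduce f) (reduce a)

reduce-inside f a (just (f′ , f≐f′)) _                  = just (f′ · a , ∀E-eqF f≐f′ a)
reduce-inside f a nothing            (just (a′ , a≐a′)) = just (f · a′ , ⊃E (dg-axiom (ext f a a′)) a≐a′)
reduce-inside f a nothing            nothing            = nothing

normalise : ∀ {Γ} → ℕ → (t : Tm Γ ι) → Σ (Tm Γ ι) λ u → ∀ {Δ : List (Fm Γ)} → Δ ⊢ t ≐ u
normalise zero    t = t , ≐-refl t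
normalise (suc n) t with reduce t
... | nothing           = t , ≐-refl t
... | just (t′ , t≐t′) = proj₁ (normalise n t′) , ≐-trans t≐t′ (proj₂ (normalise n t′))

fuel : ℕ
fuel = 30000

≐-by-computation : ∀ {Γ} {Δ : List (Fm Γ)} {s t : Tm Γ ι} →
                   proj₁ (normalise fuel s) ≡ proj₁ (normalise fuel t) → Δ ⊢ s ≐ t
≐-by-computation {Δ = Δ} {s} {t} nf≡nf =
  ≐-trans (proj₂ (normalise fuel s))
          (≐-sym (subst (λ u → Δ ⊢ t ≐ u) (sym nf≡nf) (proj₂ (normalise fuel t))))

-- Stated internally so that, under ∀I, the premises are available as hypotheses.
eqF-trans-internal : ∀ {Γ} {Δ : List (Fm Γ)} (τ : Ty) (a b c : Tm Γ τ) →
                     Δ ⊢ eqF τ a b ⊃ eqF τ b c ⊃ eqF τ a c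
eqF-trans-internal ι       a b c = ⊃I (⊃I (≐-trans hyp₁ hyp₀))
eqF-trans-internal {Γ} (ρ ⇒ τ) a b c = ⊃I (⊃I (∀I
  (⊃E (⊃E (eqF-trans-internal τ _ _ _) (pointwise a b hyp₁)) (pointwise b c hyp₀))))
  where
  pointwise : ∀ {Δ′} (f g : Tm Γ (ρ ⇒ τ)) → Δ′ ⊢ wkF (eqF (ρ ⇒ τ) f g) → Δ′ ⊢ eqF τ (wkT f · v0) (wkT g · v0)
  pointwise {Δ′} f g f≐g = ∀E-eqF (subst (Δ′ ⊢_) (renF-eqF there (ρ ⇒ τ) f g) f≐g) v0

eqF-trans : ∀ {Γ} {Δ : List (Fm Γ)} {τ} {a b c : Tm Γ τ} → Δ ⊢ eqF τ a b → Δ ⊢ eqF τ b c → Δ ⊢ eqF τ a c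
eqF-trans {τ = τ} a≐b b≐c = ⊃E (⊃E (eqF-trans-internal τ _ _ _) a≐b) b≐c

eqF-cong-app : ∀ {Γ} {Δ : List (Fm Γ)} {ρ τ} {f g : Tm Γ (ρ ⇒ τ)} {a b : Tm Γ ρ} →
               Δ ⊢ eqF (ρ ⇒ τ) f g → Δ ⊢ eqF ρ a b → Δ ⊢ eqF τ (f · a) (g · b)
eqF-cong-app {g = g} {a} {b} f≐g a≐b = eqF-trans (∀E-eqF f≐g a) (⊃E (dg-axiom (ext g a b)) a≐b)

infixl 5 _,ₛ_
_,ₛ_ : ∀ {Γ Θ σ} → Sub Γ Θ → Tm Θ σ → Sub (σ ∷ Γ) Θ
(s ,ₛ a) here      = a
(s ,ₛ a) (there x) = s x

-- Bracket abstraction commutes with substitution only up to provable equality,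
-- so β is stated for substitution instances of lam t.
lam-β : ∀ {Γ Θ σ τ} (s : Sub Γ Θ) (t : Tm (σ ∷ Γ) τ) (a : Tm Θ σ) {Δ : List (Fm Θ)} →
        Δ ⊢ eqF τ (subT s (lam t) · a) (subT (s ,ₛ a) t)
lam-β s (var here)      a = eqF-trans (dg-axiom (ax-S Kc Kc a)) (dg-axiom (ax-K a (Kc · a)))
lam-β s (var (there x)) a = dg-axiom (ax-K (s x) a)
lam-β s zer             a = dg-axiom (ax-K zer a)
lam-β s suc'            a = dg-axiom (ax-K suc' a)
lam-β s Kc              a = dg-axiom (ax-K Kc a)
lam-β s Sc              a = dg-axiom (ax-K Sc a)
lam-β s Rc              a = dg-axiom (ax-K Rc a)
lam-β s (t · u)         a = eqF-trans (dg-axiom (ax-S (subT s (lam t)) (subT s (lam u)) a))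
                                      (eqF-cong-app (lam-β s t a) (lam-β s u a))

lam²-β : ∀ {Γ ρ σ} {Δ : List (Fm Γ)} (t : Tm (σ ∷ ρ ∷ []) ι) (a : Tm Γ ρ) (b : Tm Γ σ) →
         Δ ⊢ subT (λ ()) (lam (lam t)) · a · b ≐ subT ((λ ()) ,ₛ a ,ₛ b) t
lam²-β t a b = eqF-trans (∀E-eqF (lam-β (λ ()) (lam t) a) b) (lam-β ((λ ()) ,ₛ a) t b)

-- Normalising pair at concrete arguments takes tens of thousands of reduction
-- steps, hence this unfolding by β; likewise, computations below are only run
-- on variables and then instantiated.
pair-β : ∀ {Γ} {Δ : List (Fm Γ)} (m n : Tm Γ ι) → Δ ⊢ pair · m · n ≐ plus · (tri · (plus · m · n)) · n
pair-β = lam²-β (plus · (tri · (plus · v1 · v0)) · v0)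

induction : ∀ {Γ} {Δ : List (Fm Γ)} (φ : Fm (ι ∷ Γ)) → Internal φ →
            Δ ⊢ φ [ zer ] → Δ ⊢ All ι (φ ⊃ subF sucSub φ) → Δ ⊢ All ι φ
induction φ internal base step = ⊃E (dg-axiom (ind φ internal)) (∧I base step)

one : ∀ {Γ} → Tm Γ ι
one = suc' · zer

pred′ : ∀ {Γ} → Tm Γ (ι ⇒ ι)
pred′ = Rc · zer · (Kc · Ic)

infixl 8 _∸′_
_∸′_ : ∀ {Γ} → Tm Γ ι → Tm Γ ι → Tm Γ ι
m ∸′ n = Rc · m · (Sc · (Kc · Kc) · pred′) · n

isZero : ∀ {Γ} → Tm Γ (ι ⇒ ι)
isZero = Rc · one · (Kc · (Kc · zer))

χ≤ : ∀ {Γ} → Tm Γ (ι ⇒ ι ⇒ ι)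
χ≤ = lam (lam (isZero · (v0 ∸′ v1)))

zero-or-nonzero : ∀ {Γ} {Δ : List (Fm Γ)} → Δ ⊢ All ι (v0 ≐ zer ∨' ¬' (v0 ≐ zer))
zero-or-nonzero = induction _ (i-or i-eq (i-imp i-eq i-bot))
  (∨I₁ (≐-refl zer))
  (∀I (⊃I (∨I₂ (dg-axiom (suc-ne0 v0)))))

[1+m]∸[1+n]≐m∸n : ∀ {Γ} {Δ : List (Fm Γ)} → Δ ⊢ All ι (All ι (suc' · v0 ∸′ suc' · v1 ≐ v0 ∸′ v1))
[1+m]∸[1+n]≐m∸n = induction _ (i-all i-eq)
  (∀I (≐-by-computation refl))
  (∀I (⊃I (∀I (begin
    suc' · v0 ∸′ suc' · (suc' · v1)   ≈⟨ ≐-by-computation refl ⟩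
    pred′ · (suc' · v0 ∸′ suc' · v1)  ≈⟨ ≐-cong (pred′ · v0) (∀E hyp₀ v0) ⟩
    pred′ · (v0 ∸′ v1)                ≈⟨ ≐-by-computation refl ⟩
    v0 ∸′ suc' · v1                   ∎))))
  where open ≐-Reasoning

n∸n≐0 : ∀ {Γ} {Δ : List (Fm Γ)} → Δ ⊢ All ι (v0 ∸′ v0 ≐ zer)
n∸n≐0 = induction _ i-eq
  (≐-by-computation refl)
  (∀I (⊃I (≐-trans (∀E (∀E [1+m]∸[1+n]≐m∸n v0) v0) hyp₀)))

m∸[m+n]≐0 : ∀ {Γ} {Δ : List (Fm Γ)} → Δ ⊢ All ι (All ι (v0 ∸′ (plus · v0 · v1) ≐ zer))
m∸[m+n]≐0 = induction _ (i-all i-eq)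
  (∀I (≐-trans (≐-by-computation refl) (∀E n∸n≐0 v0)))
  (∀I (⊃I (∀I (begin
    v0 ∸′ (plus · v0 · (suc' · v1))   ≈⟨ ≐-by-computation refl ⟩
    pred′ · (v0 ∸′ (plus · v0 · v1))  ≈⟨ ≐-cong (pred′ · v0) (∀E hyp₀ v0) ⟩
    pred′ · zer                        ≈⟨ ≐-by-computation refl ⟩
    zer                                ∎))))
  where open ≐-Reasoning

[1+m+n]∸n≐1+m : ∀ {Γ} {Δ : List (Fm Γ)} → Δ ⊢ All ι (All ι (suc' · (plus · v0 · v1) ∸′ v1 ≐ suc' · v0))
[1+m+n]∸n≐1+m = induction _ (i-all i-eq)
  (∀I (≐-by-computation refl))
  (∀I (⊃I (∀I (begin
    suc' · (plus · v0 · (suc' · v1)) ∸′ suc' · v1        ≈⟨ ≐-by-computation refl ⟩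
    suc' · (suc' · (plus · v0 · v1)) ∸′ suc' · v1        ≈⟨ ∀E (∀E [1+m]∸[1+n]≐m∸n v1) (suc' · (plus · v0 · v1)) ⟩
    suc' · (plus · v0 · v1) ∸′ v1                        ≈⟨ ∀E hyp₀ v0 ⟩
    suc' · v0                                            ∎))))
  where open ≐-Reasoning

isZero≤1 : ∀ {Γ} {Δ : List (Fm Γ)} → Δ ⊢ All ι ((isZero · v0) ≤₀ one)
isZero≤1 = induction _ (i-ex i-eq)
  (∃I zer (≐-by-computation refl))
  (∀I (⊃I (∃I one (≐-by-computation refl))))

0≤₀0 : ∀ {Γ} {Δ : List (Fm Γ)} → Δ ⊢ zer ≤₀ zer
0≤₀0 = ∃I zer (≐-by-computation refl)

plus-suc : ∀ {Γ} {Δ : List (Fm Γ)} → Δ ⊢ All ι (All ι (plus · v1 · (suc' · v0) ≐ suc' · (plus · v1 · v0)))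
plus-suc = ∀I (∀I (≐-by-computation refl))

isZero-suc : ∀ {Γ} {Δ : List (Fm Γ)} → Δ ⊢ All ι (isZero · (suc' · v0) ≐ zer)
isZero-suc = ∀I (≐-by-computation refl)

χ≤-unfold : ∀ {Γ} {Δ : List (Fm Γ)} → Δ ⊢ All ι (All ι (χ≤ · v1 · v0 ≐ isZero · (v0 ∸′ v1)))
χ≤-unfold = ∀I (∀I (≐-by-computation refl))

χ≤-[n+d]-n≐1 : ∀ {Γ} {Δ : List (Fm Γ)} → Δ ⊢ All ι (All ι (χ≤ · (plus · v1 · v0) · v1 ≐ one))
χ≤-[n+d]-n≐1 = ∀I (∀I (begin
  χ≤ · (plus · v1 · v0) · v1        ≈⟨ ∀E (∀E χ≤-unfold (plus · v1 · v0)) v1 ⟩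
  isZero · (v1 ∸′ plus · v1 · v0)   ≈⟨ ≐-cong (isZero · v0) (∀E (∀E m∸[m+n]≐0 v0) v1) ⟩
  isZero · zer                      ≈⟨ ≐-by-computation refl ⟩
  one                               ∎))
  where open ≐-Reasoning

χ≤-x-⟨0,1+x⟩≐0 : ∀ {Γ} {Δ : List (Fm Γ)} → Δ ⊢ All ι (χ≤ · v0 · (pair · zer · (suc' · v0)) ≐ zer)
χ≤-x-⟨0,1+x⟩≐0 {Γ} = ∀I (begin
  χ≤ · v0 · (pair · zer · (suc' · v0))       ≈⟨ ≐-cong (χ≤ · v1 · v0) (pair-β zer (suc' · v0)) ⟩
  χ≤ · v0 · (plus · T · (suc' · v0))         ≈⟨ ≐-cong (χ≤ · v1 · v0) (∀E (∀E plus-suc T) v0) ⟩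
  χ≤ · v0 · (suc' · (plus · T · v0))         ≈⟨ ∀E (∀E χ≤-unfold v0) (suc' · (plus · T · v0)) ⟩
  isZero · (suc' · (plus · T · v0) ∸′ v0)    ≈⟨ ≐-cong (isZero · v0) (∀E (∀E [1+m+n]∸n≐1+m v0) T) ⟩
  isZero · (suc' · T)                        ≈⟨ ∀E isZero-suc T ⟩
  zer                                        ∎)
  where
  open ≐-Reasoning
  T : Tm (ι ∷ Γ) ι
  T = tri · (plus · zer · (suc' · v0))

χ≤-x-k≐0⇒¬k≤x : ∀ {Γ} {Δ : List (Fm Γ)} → Δ ⊢ All ι (All ι (χ≤ · v0 · v1 ≐ zer ⊃ ¬' (v1 ≤₀ v0)))
χ≤-x-k≐0⇒¬k≤x = ∀I (∀I (⊃I (⊃I (∃E hyp₀ (⊃E (dg-axiom (suc-ne0 zer)) (begin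
  one                          ≈⟨ ∀E (∀E χ≤-[n+d]-n≐1 v2) v0 ⟨
  χ≤ · (plus · v2 · v0) · v2   ≈⟨ ≐-cong (χ≤ · v0 · v3) hyp₀ ⟩
  χ≤ · v1 · v2                 ≈⟨ hyp₂ ⟩
  zer                          ∎))))))
  where open ≐-Reasoning

χ≤≤₀1 : ∀ {Γ} {Δ : List (Fm Γ)} → Δ ⊢ All ι (All ι ((χ≤ · v1 · v0) ≤₀ one))
χ≤≤₀1 = ∀I (∀I (∃E (∀E isZero≤1 (v0 ∸′ v1)) (∃I v0 (≐-trans (≐-by-computation refl) hyp₀))))

χ≤-binary : ∀ {Γ} {Δ : List (Fm (ι ∷ Γ))} → Δ ⊢ leF τ₁ (χ≤ · v0) oneF
χ≤-binary = ∀I (∃E (∀E (∀E χ≤≤₀1 v1) v0) (∃I v0 (≐-trans hyp₀ (≐-by-computation refl))))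

χ≤-majorised-by-oneF : ∀ {Γ} {Δ : List (Fm (ι ∷ Γ))} → Δ ⊢ maj τ₁ (χ≤ · v0) oneF
χ≤-majorised-by-oneF = ∀I (∀I (⊃I (∧I
  (∃E (∀E (∀E χ≤≤₀1 v2) v1) (∃I v0 (≐-trans hyp₀ (≐-by-computation refl))))
  (∃I zer (≐-by-computation refl)))))

st-· : ∀ {Γ} {Δ : List (Fm Γ)} {σ τ} {f : Tm Γ (σ ⇒ τ)} {a : Tm Γ σ} →
       Δ ⊢ St f → Δ ⊢ St a → Δ ⊢ St (f · a)
st-· {f = f} {a} st-f st-a = ⊃E (⊃E (dg-axiom (st-app f a)) st-f) st-a

χ≤-standard : ∀ {Γ} {Δ : List (Fm (ι ∷ Γ))} → Δ ⊢ St (χ≤ · v0)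
χ≤-standard = ⊃E (⊃E (dg-axiom (st-maj (χ≤ · v0) oneF)) (dg-axiom (st-closed oneF))) χ≤-majorised-by-oneF

StandardPairAbove : ∀ {Γ} → Tm Γ ι → Fm Γ
StandardPairAbove x = ExSt ι (χ≤ · wkT x · (pair · zer · v0) ≐ zer)

standard-pair-above : ∀ {Γ} {Δ : List (Fm Γ)} {x : Tm Γ ι} → Δ ⊢ St x → Δ ⊢ StandardPairAbove x
standard-pair-above {Δ = Δ} {x} st-x = ∃I (suc' · x) (∧I
  (st-· (dg-axiom (st-closed suc')) st-x)
  (subst (λ y → Δ ⊢ χ≤ · y · (pair · zer · (suc' · x)) ≐ zer)
         (sym (subT-sub0-wkT (suc' · x) x))
         (∀E χ≤-x-⟨0,1+x⟩≐0 x)))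

zero-test-decides : ∀ {Γ} {Δ : List (Fm Γ)} {φ : Fm Γ} → Δ ⊢ Ex τ₁ (wkF φ ⇔' (v0 · zer ≐ zer)) → Δ ⊢ φ ∨' ¬' φ
zero-test-decides φ⇔g0≐0 = ∃E φ⇔g0≐0 (∨E (∀E zero-or-nonzero (v0 · zer))
  (∨I₁ (⊃E (∧E₂ hyp₁) hyp₀))
  (∨I₂ (⊃I (⊃E hyp₁ (⊃E (∧E₁ hyp₂) hyp₀)))))

aca-at-χ≤ : ∀ {Γ} {Δ : List (Fm (ι ∷ Γ))} → Δ ⊢ Ex τ₁ (wkF (StandardPairAbove v0) ⇔' (v0 · zer ≐ zer))
aca-at-χ≤ = ∃E (⊃E (⊃E (∀E aca-axiom (χ≤ · v0)) χ≤-standard) χ≤-binary)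
  (∃I v0 (⊃E (∀E (∧E₂ (∧E₂ hyp₀)) zer) (dg-axiom (st-closed zer))))

standard-pair-above-decidable : ∀ {Γ} {Δ : List (Fm (ι ∷ Γ))} →
                                Δ ⊢ StandardPairAbove v0 ∨' ¬' (StandardPairAbove v0)
standard-pair-above-decidable = zero-test-decides {φ = StandardPairAbove v0} aca-at-χ≤

Witness : ∀ {Γ} → Fm (ι ∷ ι ∷ Γ)
Witness = StandardPairAbove v1 ⊃ χ≤ · v1 · (pair · zer · v0) ≐ zer

standard-witness : ∀ {Γ} {Δ : List (Fm Γ)} → Δ ⊢ All ι (ExSt ι Witness)
standard-witness = ∀I (∨E standard-pair-above-decidable
  (∃E hyp₀ (∃I v0 (∧I (∧E₁ hyp₀) (⊃I (∧E₂ hyp₁)))))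
  (∃I zer (∧I (dg-axiom (st-closed zer)) (⊃I (⊥E (⊃E hyp₁ hyp₀))))))

UniformBound : ∀ {Γ} → Fm (ι ∷ Γ)
UniformBound = All ι (ExLe ι v1 (renF skip2 Witness))

witness-refuted : ∀ {Γ} {Δ : List (Fm (ι ∷ (ι ⇒ ι ⇒ ι) ∷ ι ∷ Γ))} →
  Δ ⊢ St v1 → Δ ⊢ St v2 → Δ ⊢ (pair · zer · v0) ≤₀ (v1 · zer · v2) →
  Δ ⊢ StandardPairAbove (v1 · zer · v2) ⊃ χ≤ · (v1 · zer · v2) · (pair · zer · v0) ≐ zer → Δ ⊢ ⊥'
witness-refuted st-p st-z ⟨0,m⟩≤x witness =
  ⊃E (⊃E (∀E (∀E χ≤-x-k≐0⇒¬k≤x (pair · zer · v0)) (v1 · zer · v2))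
         (⊃E witness (standard-pair-above (st-· (st-· st-p (dg-axiom (st-closed zer))) st-z))))
     ⟨0,m⟩≤x

-- The standard majorant p of pair provided by MAJ is used in place: a lemma
-- stating p ≥* pair at type 0 → 0 → 0 forces pair to be normalised when checked.
no-standard-uniform-bound : ∀ {Γ} {Δ : List (Fm Γ)} → Δ ⊢ All ι (St v0 ⊃ UniformBound ⊃ ⊥')
no-standard-uniform-bound = ∀I (⊃I (⊃I
  (∃E (⊃E (∀E (dg-axiom (MAJ (ι ⇒ ι ⇒ ι))) pair) (dg-axiom (st-closed pair)))
  (∃E (∀E hyp₁ (v0 · zer · v1))
    (witness-refuted (∧E₁ hyp₁) hyp₃
      (∧E₁ (⊃E (∀E (∀E (∧E₁ (⊃E (∀E (∀E (∧E₂ hyp₁) zer) zer) 0≤₀0)) v0) v2) (∧E₁ hyp₀)))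
      (∧E₂ hyp₀))))))

theorem3p13 : Inconsistent DG+ACAst
theorem3p13 =
  ∃E (⊃E (dg-axiom (Rω Witness)) standard-witness)
     (⊃E (⊃E (∀E no-standard-uniform-bound v0) (∧E₁ (∧E₂ hyp₀))) (∧E₂ (∧E₂ hyp₀)))
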